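{- There are infinitely many pairs $(n,X)$ of positive integers with $n\geq 3$ such that the $n$-tuple $(1,\ldots,1,2,X,X)$ (with $n-3$ ones) satisfies $\sigma_2=\sigma_n$ and $2\leq X$. In particular, $$\liminf_{n\to+\infty}\ \min_{(x_1,\ldots,x_n)\in S(n)}\frac{x_n}{x_{n-1}}=1,$$ where $S(n)$ is the set of $n$-tuples $(x_1,\ldots,x_n)$ of positive integers with $x_1\leq\cdots\leq x_n$ and $\sigma_2(x_1,\ldots,x_n)=\sigma_n(x_1,\ldots,x_n)$.
   Context: $\sigma_k$ denotes the $k$-th elementary symmetric polynomial in $n$ variables. -}

module Defs where

open import Data.Nat using (ℕ; zero; suc; _+_; _*_; _∸_; _≤_; _<_)
open import Data.List using (List; []; _∷_; _++_; replicate; length)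
open import Data.List.Relation.Unary.All using (All)
open import Data.List.Relation.Unary.Linked using (Linked)
open import Data.Product using (_×_; ∃-syntax)
open import Relation.Binary.PropositionalEquality using (_≡_)

σ : ℕ → List ℕ → ℕ
σ zero    _        = 1
σ (suc k) []       = 0
σ (suc k) (x ∷ xs) = x * σ k xs + σ (suc k) xs

tuple : ℕ → ℕ → List ℕ
tuple n X = replicate (n ∸ 3) 1 ++ (2 ∷ X ∷ X ∷ [])

InS : ℕ → List ℕ → Set
InS n xs = length xs ≡ n × All (λ x → 0 < x) xs × Linked _≤_ xs × σ 2 xs ≡ σ n xs

LastTwoEqual : List ℕ → Set
LastTwoEqual xs = ∃[ ys ] ∃[ z ] (xs ≡ ys ++ (z ∷ z ∷ []))

{-# OPTIONS --safe #-}
-- With m = n − 3 ones, σₙ(1,…,1,2,X,X) = 2X² and 2σ₂ = m(m − 1) + 4m(1 + X) + 8X + 2X²,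
-- so after substituting X = m + 2 + s the equation σ₂ = σₙ becomes 2s² = (m + 1)(3m + 8).
-- This Pell-type equation has the solution (m, s) = (0, 2) and an automorphism that
-- strictly increases m, hence infinitely many solutions.
module Submission where

open import Defs
open import Data.Nat using (ℕ; zero; suc; _+_; _*_; _∸_; _≤_; _<_; z≤n; s≤s)
open import Data.Nat.Properties
open import Data.Nat.Tactic.RingSolver using (solve-∀)
open import Data.List using ([]; _∷_; _++_; replicate; length)
open import Data.List.Properties using (length-++; length-replicate; ++-assoc)
open import Data.List.Relation.Unary.All using (All; []; _∷_)
open import Data.List.Relation.Unary.All.Properties using (++⁺; replicate⁺)
open import Data.List.Relation.Unary.Linked using (Linked; [-]; _∷_)
open import Data.Product using (_×_; ∃-syntax; _,_)
open import Relation.Binary.PropositionalEquality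
open ≡-Reasoning

σ-vanishes : ∀ {k} xs → length xs < k → σ k xs ≡ 0
σ-vanishes {suc k} []       _        = refl
σ-vanishes {suc k} (x ∷ xs) (s≤s lt) = begin
  x * σ k xs + σ (suc k) xs  ≡⟨ cong₂ (λ a b → x * a + b) (σ-vanishes xs lt) (σ-vanishes xs (m<n⇒m<1+n lt)) ⟩
  x * 0 + 0                  ≡⟨ cong (_+ 0) (*-zeroʳ x) ⟩
  0                          ∎

length-replicate-++ : ∀ m (x : ℕ) xs → length (replicate m x ++ xs) ≡ m + length xs
length-replicate-++ m x xs = trans (length-++ (replicate m x)) (cong (_+ length xs) (length-replicate m))

σ-ones-top : ∀ m {k} xs → length xs ≤ k → σ (m + k) (replicate m 1 ++ xs) ≡ σ k xs
σ-ones-top zero        xs le = refl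
σ-ones-top (suc m) {k} xs le = begin
  1 * σ (m + k) L + σ (suc (m + k)) L  ≡⟨ cong₂ _+_ (*-identityˡ _) (σ-vanishes L (s≤s length-L≤m+k)) ⟩
  σ (m + k) L + 0                      ≡⟨ +-identityʳ _ ⟩
  σ (m + k) L                          ≡⟨ σ-ones-top m xs le ⟩
  σ k xs                               ∎
  where
    L = replicate m 1 ++ xs
    length-L≤m+k : length L ≤ m + k
    length-L≤m+k = ≤-trans (≤-reflexive (length-replicate-++ m 1 xs)) (+-monoʳ-≤ m le)

σ₁-ones : ∀ m xs → σ 1 (replicate m 1 ++ xs) ≡ m + σ 1 xs
σ₁-ones zero    xs = refl
σ₁-ones (suc m) xs = cong suc (σ₁-ones m xs)

-- The summand m on the left accounts for the −m in 2·C(m,2) = m² − m.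
σ₂-ones : ∀ m xs → 2 * σ 2 (replicate m 1 ++ xs) + m ≡ m * m + 2 * m * σ 1 xs + 2 * σ 2 xs
σ₂-ones zero    xs = +-identityʳ _
σ₂-ones (suc m) xs = begin
  2 * (1 * σ 1 L + σ 2 L) + suc m
    ≡⟨ cong (λ t → 2 * (1 * t + σ 2 L) + suc m) (σ₁-ones m xs) ⟩
  2 * (1 * (m + a) + c) + suc m
    ≡⟨ regroup m a c ⟩
  (2 * c + m) + 2 * (m + a) + 1
    ≡⟨ cong (λ t → t + 2 * (m + a) + 1) (σ₂-ones m xs) ⟩
  m * m + 2 * m * a + 2 * b + 2 * (m + a) + 1
    ≡⟨ complete-square m a b ⟩
  suc m * suc m + 2 * suc m * a + 2 * b ∎
  where
    L = replicate m 1 ++ xs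
    a = σ 1 xs
    b = σ 2 xs
    c = σ 2 L
    regroup : ∀ m a c → 2 * (1 * (m + a) + c) + suc m ≡ (2 * c + m) + 2 * (m + a) + 1
    regroup = solve-∀
    complete-square : ∀ m a b → m * m + 2 * m * a + 2 * b + 2 * (m + a) + 1 ≡ suc m * suc m + 2 * suc m * a + 2 * b
    complete-square = solve-∀

σ₁-triple : ∀ a b c → σ 1 (a ∷ b ∷ c ∷ []) ≡ a + b + c
σ₁-triple = unfolded
  where
    unfolded : ∀ a b c → a * 1 + (b * 1 + (c * 1 + 0)) ≡ a + b + c
    unfolded = solve-∀

σ₂-triple : ∀ a b c → σ 2 (a ∷ b ∷ c ∷ []) ≡ a * b + a * c + b * c
σ₂-triple = unfolded
  where
    unfolded : ∀ a b c → a * (b * 1 + (c * 1 + 0)) + (b * (c * 1 + 0) + (c * 0 + 0)) ≡ a * b + a * c + b * c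
    unfolded = solve-∀

σ₃-triple : ∀ a b c → σ 3 (a ∷ b ∷ c ∷ []) ≡ a * b * c
σ₃-triple = unfolded
  where
    unfolded : ∀ a b c → a * (b * (c * 1 + 0) + (c * 0 + 0)) + (b * (c * 0 + 0) + (c * 0 + 0)) ≡ a * b * c
    unfolded = solve-∀

tuple-σₙ : ∀ m X → σ (3 + m) (tuple (3 + m) X) ≡ 2 * X * X
tuple-σₙ m X = begin
  σ (3 + m) (replicate m 1 ++ 2 ∷ X ∷ X ∷ [])  ≡⟨ cong (λ k → σ k (replicate m 1 ++ 2 ∷ X ∷ X ∷ [])) (+-comm 3 m) ⟩
  σ (m + 3) (replicate m 1 ++ 2 ∷ X ∷ X ∷ [])  ≡⟨ σ-ones-top m (2 ∷ X ∷ X ∷ []) ≤-refl ⟩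
  σ 3 (2 ∷ X ∷ X ∷ [])                         ≡⟨ σ₃-triple 2 X X ⟩
  2 * X * X                                    ∎

tuple-σ₂ : ∀ m X → 2 * σ 2 (tuple (3 + m) X) + m ≡ m * m + 2 * m * (2 + X + X) + 2 * (2 * X + 2 * X + X * X)
tuple-σ₂ m X = begin
  2 * σ 2 (replicate m 1 ++ ys) + m                                   ≡⟨ σ₂-ones m ys ⟩
  m * m + 2 * m * σ 1 ys + 2 * σ 2 ys                                 ≡⟨ cong₂ (λ a b → m * m + 2 * m * a + 2 * b) (σ₁-triple 2 X X) (σ₂-triple 2 X X) ⟩
  m * m + 2 * m * (2 + X + X) + 2 * (2 * X + 2 * X + X * X)           ∎
  where ys = 2 ∷ X ∷ X ∷ []

tuple-σ₂≡σₙ : ∀ m s → 2 * s * s ≡ (m + 1) * (3 * m + 8) →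
              σ 2 (tuple (3 + m) (m + 2 + s)) ≡ σ (3 + m) (tuple (3 + m) (m + 2 + s))
tuple-σ₂≡σₙ m s pell = trans (*-cancelˡ-≡ _ _ 2 (+-cancelʳ-≡ m _ _ (+-cancelʳ-≡ (2 * s * s) _ _ doubled)))
                             (sym (tuple-σₙ m X))
  where
    X = m + 2 + s
    expand : ∀ m s → let X = m + 2 + s in
             m * m + 2 * m * (2 + X + X) + 2 * (2 * X + 2 * X + X * X) + 2 * s * s ≡ 2 * (2 * X * X) + m + (m + 1) * (3 * m + 8)
    expand = solve-∀
    doubled : 2 * σ 2 (tuple (3 + m) X) + m + 2 * s * s ≡ 2 * (2 * X * X) + m + 2 * s * s
    doubled = begin
      2 * σ 2 (tuple (3 + m) X) + m + 2 * s * s                                ≡⟨ cong (_+ 2 * s * s) (tuple-σ₂ m X) ⟩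
      m * m + 2 * m * (2 + X + X) + 2 * (2 * X + 2 * X + X * X) + 2 * s * s   ≡⟨ expand m s ⟩
      2 * (2 * X * X) + m + (m + 1) * (3 * m + 8)                             ≡⟨ cong (2 * (2 * X * X) + m +_) (sym pell) ⟩
      2 * (2 * X * X) + m + 2 * s * s                                          ∎

record PellSolution : Set where
  field
    m s      : ℕ
    equation : 2 * s * s ≡ (m + 1) * (3 * m + 8)

-- With u = 6m + 11 the equation reads u² − 24s² = 25, and next multiplies
-- u + s√24 by the unit 49 + 10√24.
next : PellSolution → PellSolution
next p = record { m = m′ ; s = s′ ; equation = +-cancelʳ-≡ ((m + 1) * (3 * m + 8)) _ _ equation′ }
  where
    open PellSolution p
    m′ s′ : ℕ
    m′ = 49 * m + 88 + 40 * s
    s′ = 60 * m + 110 + 49 * s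
    invariant : ∀ m s → let m′ = 49 * m + 88 + 40 * s ; s′ = 60 * m + 110 + 49 * s in
                2 * s′ * s′ + (m + 1) * (3 * m + 8) ≡ (m′ + 1) * (3 * m′ + 8) + 2 * s * s
    invariant = solve-∀
    equation′ : 2 * s′ * s′ + (m + 1) * (3 * m + 8) ≡ (m′ + 1) * (3 * m′ + 8) + (m + 1) * (3 * m + 8)
    equation′ = begin
      2 * s′ * s′ + (m + 1) * (3 * m + 8)              ≡⟨ invariant m s ⟩
      (m′ + 1) * (3 * m′ + 8) + 2 * s * s              ≡⟨ cong ((m′ + 1) * (3 * m′ + 8) +_) equation ⟩
      (m′ + 1) * (3 * m′ + 8) + (m + 1) * (3 * m + 8)  ∎

pell-solution : ℕ → PellSolution
pell-solution zero    = record { m = 0 ; s = 2 ; equation = refl }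
pell-solution (suc k) = next (pell-solution k)

m<m-next : ∀ p → PellSolution.m p < PellSolution.m (next p)
m<m-next p = ≤-trans (m≤m+n (suc m) (48 * m + 87 + 40 * s)) (≤-reflexive (split m s))
  where
    open PellSolution p
    split : ∀ m s → suc m + (48 * m + 87 + 40 * s) ≡ 49 * m + 88 + 40 * s
    split = solve-∀

k≤m-pell-solution : ∀ k → k ≤ PellSolution.m (pell-solution k)
k≤m-pell-solution zero    = z≤n
k≤m-pell-solution (suc k) = ≤-trans (s≤s (k≤m-pell-solution k)) (m<m-next (pell-solution k))

replicate-++-sorted : ∀ m {x y ys} → x ≤ y → Linked _≤_ (y ∷ ys) → Linked _≤_ (replicate m x ++ y ∷ ys)
replicate-++-sorted zero          x≤y sorted = sorted
replicate-++-sorted (suc zero)    x≤y sorted = x≤y ∷ sorted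
replicate-++-sorted (suc (suc m)) x≤y sorted = ≤-refl ∷ replicate-++-sorted (suc m) x≤y sorted

tuple-InS : ∀ m X → 2 ≤ X → σ 2 (tuple (3 + m) X) ≡ σ (3 + m) (tuple (3 + m) X) → InS (3 + m) (tuple (3 + m) X)
tuple-InS m X 2≤X balanced =
    trans (length-replicate-++ m 1 _) (+-comm m 3)
  , ++⁺ (replicate⁺ m (s≤s z≤n)) (s≤s z≤n ∷ 0<X ∷ 0<X ∷ [])
  , replicate-++-sorted m (s≤s z≤n) (2≤X ∷ ≤-refl ∷ [-])
  , balanced
  where 0<X = ≤-trans (s≤s z≤n) 2≤X

tuple-LastTwoEqual : ∀ n X → LastTwoEqual (tuple n X)
tuple-LastTwoEqual n X = replicate (n ∸ 3) 1 ++ 2 ∷ [] , X , sym (++-assoc (replicate (n ∸ 3) 1) (2 ∷ []) (X ∷ X ∷ []))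

balanced-tuple-beyond : ∀ N → ∃[ m ] ∃[ X ] (N ≤ m × 2 ≤ X × σ 2 (tuple (3 + m) X) ≡ σ (3 + m) (tuple (3 + m) X))
balanced-tuple-beyond N =
  m , m + 2 + s , k≤m-pell-solution N , ≤-trans (m≤n+m 2 m) (m≤m+n (m + 2) s) , tuple-σ₂≡σₙ m s equation
  where open PellSolution (pell-solution N)

theorem3p4 : ((N : ℕ) → ∃[ n ] ∃[ X ] (N ≤ n + X × 3 ≤ n × 2 ≤ X × σ 2 (tuple n X) ≡ σ n (tuple n X)))
    × ((N : ℕ) → ∃[ n ] (N ≤ n × ∃[ xs ] (InS n xs × LastTwoEqual xs)))
theorem3p4 =
    (λ N → let (m , X , N≤m , 2≤X , balanced) = balanced-tuple-beyond N in
       3 + m , X , ≤-trans N≤m (≤-trans (m≤n+m m 3) (m≤m+n (3 + m) X)) , m≤m+n 3 m , 2≤X , balanced)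
  , (λ N → let (m , X , N≤m , 2≤X , balanced) = balanced-tuple-beyond N in
       3 + m , ≤-trans N≤m (m≤n+m m 3) , tuple (3 + m) X , tuple-InS m X 2≤X balanced , tuple-LastTwoEqual (3 + m) X)
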